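{- Let $\Pi$ be a projective plane of order $p^2$, $p\geq 3$ prime, and let $c\in\mathrm{C}(\Pi)^\perp$ have weight $2p^2-2p+2+\epsilon$ with $1\leq\epsilon\leq p-2$, such that every non-zero entry of $c$ equals $1$ or $p-1$ and the entry $1$ occurs. Let $K_1$ and $K_{p-1}$ be the sets of points where $c$ has entry $1$ and $p-1$ respectively. Then $\bigl||K_1|-|K_{p-1}|\bigr|\in\{0,p\}$. Moreover, if $\bigl||K_1|-|K_{p-1}|\bigr|=p$, then $\epsilon=p-2$.
   Context: $\mathrm{C}(\Pi)$ is the $\mathbb{F}_p$-span of the incidence vectors of the lines of $\Pi$, viewed as vectors indexed by points; $\mathrm{C}(\Pi)^\perp$ is the set of vectors $v$ with $\sum_{P\in\ell}v_P=0$ in $\mathbb{F}_p$ for every line $\ell$. The weight is the number of non-zero positions. Elements of $\mathbb{F}_p$ are represented by integers in $\{0,\dots,p-1\}$. -}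

module Defs where

open import Data.Nat using (ℕ; zero; suc; _+_; _*_; _∸_; _%_)
open import Data.Bool using (Bool; true; false; if_then_else_)
open import Data.Fin using (Fin; toℕ)
open import Data.List using (List; map; allFin)
open import Data.Nat.ListAction using (sum)
open import Data.Product using (Σ; ∃; _×_; _,_)
open import Relation.Binary.PropositionalEquality using (_≡_; _≢_)
open import Relation.Nullary using (¬_)
open import Relation.Nullary.Decidable using (⌊_⌋)
import Data.Nat as ℕ

count : ∀ {n} → (Fin n → Bool) → ℕ
count {n} f = sum (map (λ x → if f x then 1 else 0) (allFin n))

sumWhere : ∀ {n} → (Fin n → Bool) → (Fin n → ℕ) → ℕ
sumWhere {n} f g = sum (map (λ x → if f x then g x else 0) (allFin n))

Collinear3 : ∀ {v b} → (Fin v → Fin b → Bool) → Fin v → Fin v → Fin v → Set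
Collinear3 I P Q R = ∃ λ l → I P l ≡ true × I Q l ≡ true × I R l ≡ true

record IsProjectivePlane (v b n : ℕ) (I : Fin v → Fin b → Bool) : Set where
  field
    twoPoints : ∀ P Q → P ≢ Q →
      ∃ λ l → (I P l ≡ true × I Q l ≡ true) ×
        (∀ m → I P m ≡ true → I Q m ≡ true → m ≡ l)
    twoLines : ∀ l m → l ≢ m →
      ∃ λ P → (I P l ≡ true × I P m ≡ true) ×
        (∀ Q → I Q l ≡ true → I Q m ≡ true → Q ≡ P)
    quadrangle : ∃ λ P → ∃ λ Q → ∃ λ R → ∃ λ S →
      (P ≢ Q × P ≢ R × P ≢ S × Q ≢ R × Q ≢ S × R ≢ S) ×
      (¬ Collinear3 I P Q R × ¬ Collinear3 I P Q S ×
       ¬ Collinear3 I P R S × ¬ Collinear3 I Q R S)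
    order : ∀ l → count (λ P → I P l) ≡ suc n

-- c ∈ C(Π)^⊥ over F_p (entries represented by Fin p, i.e. {0,…,p-1}):
-- the sum of the entries on every line is 0 in F_p
InDualCode : ∀ {v b} (p : ℕ) .{{_ : ℕ.NonZero p}} →
  (Fin v → Fin b → Bool) → (Fin v → Fin p) → Set
InDualCode {b = b} p I c = ∀ (l : Fin b) → sumWhere (λ P → I P l) (λ P → toℕ (c P)) % p ≡ 0

weight : ∀ {v p} → (Fin v → Fin p) → ℕ
weight c = count (λ P → Data.Bool.not ⌊ toℕ (c P) ℕ.≟ 0 ⌋)
  where import Data.Bool

entryCount : ∀ {v p} → (Fin v → Fin p) → ℕ → ℕ
entryCount c k = count (λ P → ⌊ toℕ (c P) ℕ.≟ k ⌋)

{-# OPTIONS --safe #-}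
module Submission where

-- Let A and B be the numbers of entries 1 and p − 1 of c, and K = p(p − 1). If every line sum of a
-- weight w is divisible by p, adding up the q + 1 line sums through a point P counts every point once
-- and P a further q times, so p divides Σ w + q·w(P); if moreover w(P) ≠ 0, each of these line sums
-- is a positive multiple of p, so the total is at least p(q + 1). At a point where c is 1, with
-- q = p² and A + B = 2K + 2 + ε ≤ 2K + p, this forces B ≥ K; so c has an entry p − 1, and the same
-- argument for −c gives A ≥ K. Hence |A − B| ≤ A + B − 2K = 2 + ε ≤ p, while p divides
-- A + (p − 1)B and B + (p − 1)A, hence |A − B|. So |A − B| is 0 or p, and in the latter case 2 + ε = p.

open import Defs
open import Data.Bool using (Bool; true; false; if_then_else_; _∧_; not)
open import Data.Bool.Properties using (∧-zeroʳ; ∧-idem)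
open import Data.Empty using (⊥-elim)
open import Data.Fin using (Fin; toℕ; punchIn; _≟_) renaming (zero to fzero; suc to fsuc)
open import Data.Fin.Properties using (punchInᵢ≢i)
import Data.List as List using (map; tabulate)
open import Data.Nat using (ℕ; zero; suc; _+_; _*_; _∸_; _≤_; _<_; _≥_; z≤n; s≤s; ∣_-_∣; NonZero; >-nonZero)
import Data.Nat as ℕ
open import Data.Nat.Divisibility using (_∣_; divides; _∣0; m%n≡0⇒n∣m; ∣m+n∣m⇒∣n; m∣m*n; ∣⇒≤)
import Data.Nat.ListAction as List using (sum)
open import Data.Nat.Primality using (Prime)
open import Data.Nat.Properties hiding (_≟_)
open import Algebra.Properties.Semiring.Sum +-*-semiring
  using (sum; sum-syntax; sum-cong-≗; sum-remove; sum-replicate-zero; ∑-comm; ∑-distrib-+; *-distribˡ-sum; *-distribʳ-sum)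
open import Data.Nat.Tactic.RingSolver using (solve-∀)
open import Data.Product using (∃; _×_; _,_; proj₁; proj₂)
open import Data.Sum using (_⊎_; inj₁; inj₂)
open import Function using (_∘_; id)
open import Relation.Binary.PropositionalEquality
open import Relation.Nullary using (yes; no)
open import Relation.Nullary.Decidable using (⌊_⌋)

indicator : Bool → ℕ
indicator b = if b then 1 else 0

sum-map-tabulate : ∀ {A : Set} {n} (f : Fin n → A) (g : A → ℕ) →
  List.sum (List.map g (List.tabulate f)) ≡ ∑[ i < n ] g (f i)
sum-map-tabulate {n = zero}  f g = refl
sum-map-tabulate {n = suc n} f g = cong (g (f fzero) +_) (sum-map-tabulate (f ∘ fsuc) g)

count≡∑ : ∀ {n} (f : Fin n → Bool) → count f ≡ ∑[ i < n ] indicator (f i)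
count≡∑ f = sum-map-tabulate id (indicator ∘ f)

sumWhere≡∑ : ∀ {n} (f : Fin n → Bool) (g : Fin n → ℕ) →
  sumWhere f g ≡ ∑[ i < n ] (if f i then g i else 0)
sumWhere≡∑ f g = sum-map-tabulate id (λ i → if f i then g i else 0)

≡false⇒≢true : ∀ {x : Bool} → x ≡ false → x ≢ true
≡false⇒≢true refl ()

if-as-product : ∀ b x → (if b then x else 0) ≡ x * indicator b
if-as-product true  x = sym (*-identityʳ x)
if-as-product false x = sym (*-zeroʳ x)

∑-mono-≤ : ∀ {n} {f g : Fin n → ℕ} → (∀ i → f i ≤ g i) → sum f ≤ sum g
∑-mono-≤ {zero}  f≤g = z≤n
∑-mono-≤ {suc n} f≤g = +-mono-≤ (f≤g fzero) (∑-mono-≤ (f≤g ∘ fsuc))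

∑-∣ : ∀ {d n} {f : Fin n → ℕ} → (∀ i → d ∣ f i) → d ∣ sum f
∑-∣ {d} {n} d∣f = divides (∑[ i < n ] _∣_.quotient (d∣f i))
  (trans (sum-cong-≗ (_∣_.equality ∘ d∣f)) (sym (*-distribʳ-sum d (_∣_.quotient ∘ d∣f))))

f[i]≤∑f : ∀ {n} (f : Fin n → ℕ) i → f i ≤ sum f
f[i]≤∑f {suc n} f i = ≤-trans (m≤m+n (f i) _) (≤-reflexive (sym (sum-remove {i = i} f)))

∑-supportedAt : ∀ {n} (f : Fin n → ℕ) i → (∀ j → j ≢ i → f j ≡ 0) → sum f ≡ f i
∑-supportedAt {suc n} f i f≡0 = begin
  sum f                             ≡⟨ sum-remove {i = i} f ⟩
  f i + ∑[ j < n ] f (punchIn i j)  ≡⟨ cong (f i +_) (sum-cong-≗ (λ j → f≡0 _ (punchInᵢ≢i i j))) ⟩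
  f i + ∑[ j < n ] 0                ≡⟨ cong (f i +_) (sum-replicate-zero n) ⟩
  f i + 0                           ≡⟨ +-identityʳ (f i) ⟩
  f i                               ∎
  where open ≡-Reasoning

∑-pos⇒∃-pos : ∀ {n} (f : Fin n → ℕ) → 0 < sum f → ∃ λ i → 0 < f i
∑-pos⇒∃-pos {suc n} f ∑f>0 with f fzero in eq
... | suc _ = fzero , subst (0 <_) (sym eq) (s≤s z≤n)
... | zero with ∑-pos⇒∃-pos (f ∘ fsuc) ∑f>0
...   | i , fᵢ>0 = fsuc i , fᵢ>0

∑-select : ∀ {n} (f : Fin n → ℕ) i → ∑[ j < n ] (if ⌊ j ≟ i ⌋ then f j else 0) ≡ f i
∑-select f i = trans (∑-supportedAt _ i off) on
  where
    on : (if ⌊ i ≟ i ⌋ then f i else 0) ≡ f i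
    on with i ≟ i
    ... | yes _   = refl
    ... | no i≢i = ⊥-elim (i≢i refl)
    off : ∀ j → j ≢ i → (if ⌊ j ≟ i ⌋ then f j else 0) ≡ 0
    off j j≢i with j ≟ i
    ... | yes j≡i = ⊥-elim (j≢i j≡i)
    ... | no _    = refl

∑-indicator-unique : ∀ {n} (f g : Fin n → Bool) i → f i ≡ true → g i ≡ true →
  (∀ j → f j ≡ true → g j ≡ true → j ≡ i) → ∑[ j < n ] indicator (f j ∧ g j) ≡ 1
∑-indicator-unique f g i fᵢ gᵢ unique =
  trans (∑-supportedAt _ i off) (cong₂ (λ x y → indicator (x ∧ y)) fᵢ gᵢ)
  where
    off : ∀ j → j ≢ i → indicator (f j ∧ g j) ≡ 0
    off j j≢i with f j in fⱼ | g j in gⱼ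
    ... | false | _     = refl
    ... | true  | false = refl
    ... | true  | true  = ⊥-elim (j≢i (unique j fⱼ gⱼ))

-- The word a − b over 𝔽_(k+1), with −1 written as k.
signed : ∀ {A : Set} → ℕ → (A → ℕ) → (A → ℕ) → A → ℕ
signed k a b i = a i + k * b i

sum-signed : ∀ {n} k (a b : Fin n → ℕ) → sum (signed k a b) ≡ sum a + k * sum b
sum-signed k a b = trans (∑-distrib-+ a (λ i → k * b i)) (cong (sum a +_) (sym (*-distribˡ-sum k b)))

signed-swap-sum : ∀ k x y → (x + k * y) + (y + k * x) ≡ suc k * (x + y)
signed-swap-sum = solve-∀

module ProjectivePlane {v b q : ℕ} {I : Fin v → Fin b → Bool} (Π : IsProjectivePlane v b q I) where
  open IsProjectivePlane Π

  lineSum : (Fin v → ℕ) → Fin b → ℕ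
  lineSum w l = ∑[ Q < v ] (if I Q l then w Q else 0)

  linesThrough₂ : Fin v → Fin v → ℕ
  linesThrough₂ P Q = ∑[ l < b ] indicator (I P l ∧ I Q l)

  pointsOn₂ : Fin b → Fin b → ℕ
  pointsOn₂ l m = ∑[ R < v ] indicator (I R l ∧ I R m)

  linesThrough₂-distinct : ∀ P Q → Q ≢ P → linesThrough₂ P Q ≡ 1
  linesThrough₂-distinct P Q Q≢P with twoPoints Q P Q≢P
  ... | l , (Q∈l , P∈l) , unique = ∑-indicator-unique _ _ l P∈l Q∈l (λ m P∈m Q∈m → unique m Q∈m P∈m)

  pointsOn₂-distinct : ∀ l m → l ≢ m → pointsOn₂ l m ≡ 1
  pointsOn₂-distinct l m l≢m with twoLines l m l≢m
  ... | R , (R∈l , R∈m) , unique = ∑-indicator-unique _ _ R R∈l R∈m unique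

  line-avoiding : ∀ P → ∃ λ l → I P l ≡ false
  line-avoiding P with quadrangle
  ... | A , B , C , D , (A≢B , A≢C , _ , _ , _ , C≢D) , (¬ABC , _ , ¬ACD , _)
    with twoPoints A B A≢B | twoPoints C D C≢D | twoPoints A C A≢C
  ... | AB , (A∈AB , B∈AB) , _ | CD , (C∈CD , D∈CD) , _ | AC , (A∈AC , C∈AC) , _
    with I P AB in P∈AB | I P CD in P∈CD | I P AC in P∈AC
  ... | false | _     | _     = AB , P∈AB
  ... | true  | false | _     = CD , P∈CD
  ... | true  | true  | false = AC , P∈AC
  ... | true  | true  | true  with P ≟ A
  ...   | yes refl = ⊥-elim (¬ACD (CD , P∈CD , C∈CD , D∈CD))
  ...   | no P≢A with twoPoints P A P≢A
  ...     | _ , _ , unique = ⊥-elim (¬ABC (AB , A∈AB , B∈AB , subst (λ l → I C l ≡ true) AC≡AB C∈AC))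
    where
      AC≡AB : AC ≡ AB
      AC≡AB = trans (unique AC P∈AC A∈AC) (sym (unique AB P∈AB A∈AB))

  linesThrough : ∀ P → ∑[ l < b ] indicator (I P l) ≡ suc q
  linesThrough P with line-avoiding P
  ... | ℓ , P∉ℓ = begin
    ∑[ l < b ] indicator (I P l)                       ≡⟨ sum-cong-≗ column ⟨
    ∑[ l < b ] ∑[ R < v ] flag R l                     ≡⟨ ∑-comm (λ l R → flag R l) ⟩
    ∑[ R < v ] ∑[ l < b ] flag R l                     ≡⟨ sum-cong-≗ row ⟩
    ∑[ R < v ] indicator (I R ℓ)                       ≡⟨ count≡∑ (λ R → I R ℓ) ⟨
    count (λ R → I R ℓ)                                ≡⟨ order ℓ ⟩
    suc q                                              ∎
    where
      open ≡-Reasoning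
      -- Each R on ℓ lies on exactly one line through P, and each line through P meets ℓ exactly once.
      flag : Fin v → Fin b → ℕ
      flag R l = indicator (I P l ∧ I R ℓ ∧ I R l)

      column : ∀ l → ∑[ R < v ] flag R l ≡ indicator (I P l)
      column l with I P l in P∈l
      ... | true  = pointsOn₂-distinct ℓ l (λ { refl → ≡false⇒≢true P∉ℓ P∈l })
      ... | false = sum-replicate-zero v

      row : ∀ R → ∑[ l < b ] flag R l ≡ indicator (I R ℓ)
      row R with I R ℓ in R∈ℓ
      ... | true  = linesThrough₂-distinct P R (λ { refl → ≡false⇒≢true P∉ℓ R∈ℓ })
      ... | false = trans (sum-cong-≗ (λ l → cong indicator (∧-zeroʳ (I P l)))) (sum-replicate-zero b)

  linesThrough₂-self : ∀ P → linesThrough₂ P P ≡ suc q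
  linesThrough₂-self P = trans (sum-cong-≗ (λ l → cong indicator (∧-idem (I P l)))) (linesThrough P)

  weighted-linesThrough₂ : ∀ (w : Fin v → ℕ) P Q →
    w Q * linesThrough₂ P Q ≡ w Q + (if ⌊ Q ≟ P ⌋ then q * w Q else 0)
  weighted-linesThrough₂ w P Q with Q ≟ P
  ... | yes refl = begin
    w P * linesThrough₂ P P  ≡⟨ cong (w P *_) (linesThrough₂-self P) ⟩
    w P * suc q              ≡⟨ *-suc (w P) q ⟩
    w P + w P * q            ≡⟨ cong (w P +_) (*-comm (w P) q) ⟩
    w P + q * w P            ∎
    where open ≡-Reasoning
  ... | no Q≢P = begin
    w Q * linesThrough₂ P Q  ≡⟨ cong (w Q *_) (linesThrough₂-distinct P Q Q≢P) ⟩
    w Q * 1                  ≡⟨ *-identityʳ (w Q) ⟩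
    w Q                      ≡⟨ +-identityʳ (w Q) ⟨
    w Q + 0                  ∎
    where open ≡-Reasoning

  pencil-sum : ∀ (w : Fin v → ℕ) P → ∑[ l < b ] (if I P l then lineSum w l else 0) ≡ sum w + q * w P
  pencil-sum w P = begin
    ∑[ l < b ] (if I P l then lineSum w l else 0)            ≡⟨ sum-cong-≗ through ⟩
    ∑[ l < b ] ∑[ Q < v ] (w Q * both Q l)                   ≡⟨ ∑-comm (λ l Q → w Q * both Q l) ⟩
    ∑[ Q < v ] ∑[ l < b ] (w Q * both Q l)                   ≡⟨ sum-cong-≗ (λ Q → *-distribˡ-sum (w Q) (both Q)) ⟨
    ∑[ Q < v ] (w Q * linesThrough₂ P Q)                     ≡⟨ sum-cong-≗ (weighted-linesThrough₂ w P) ⟩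
    ∑[ Q < v ] (w Q + (if ⌊ Q ≟ P ⌋ then q * w Q else 0))    ≡⟨ ∑-distrib-+ w _ ⟩
    sum w + ∑[ Q < v ] (if ⌊ Q ≟ P ⌋ then q * w Q else 0)    ≡⟨ cong (sum w +_) (∑-select (λ Q → q * w Q) P) ⟩
    sum w + q * w P                                          ∎
    where
      open ≡-Reasoning
      both : Fin v → Fin b → ℕ
      both Q l = indicator (I P l ∧ I Q l)
      through : ∀ l → (if I P l then lineSum w l else 0) ≡ ∑[ Q < v ] (w Q * both Q l)
      through l with I P l
      ... | true  = sum-cong-≗ λ Q → if-as-product (I Q l) (w Q)
      ... | false = sym (trans (sum-cong-≗ (λ Q → *-zeroʳ (w Q))) (sum-replicate-zero v))

  module _ {d : ℕ} (w : Fin v → ℕ) (d∣lineSum : ∀ l → d ∣ lineSum w l) (P : Fin v) where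

    pencil-∣ : d ∣ sum w + q * w P
    pencil-∣ = subst (d ∣_) (pencil-sum w P) (∑-∣ through)
      where
        through : ∀ l → d ∣ (if I P l then lineSum w l else 0)
        through l with I P l
        ... | true  = d∣lineSum l
        ... | false = d ∣0

    pencil-≥ : 0 < w P → d * suc q ≤ sum w + q * w P
    pencil-≥ wP>0 = begin
      d * suc q                                       ≡⟨ cong (d *_) (linesThrough P) ⟨
      d * ∑[ l < b ] indicator (I P l)                ≡⟨ *-distribˡ-sum d (λ l → indicator (I P l)) ⟩
      ∑[ l < b ] (d * indicator (I P l))              ≤⟨ ∑-mono-≤ through ⟩
      ∑[ l < b ] (if I P l then lineSum w l else 0)   ≡⟨ pencil-sum w P ⟩
      sum w + q * w P                                 ∎
      where
        open ≤-Reasoning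
        through : ∀ l → d * indicator (I P l) ≤ (if I P l then lineSum w l else 0)
        through l with I P l in P∈l
        ... | false = ≤-reflexive (*-zeroʳ d)
        ... | true  = begin
          d * 1         ≡⟨ *-identityʳ d ⟩
          d             ≤⟨ ∣⇒≤ {{>-nonZero lineSum>0}} (d∣lineSum l) ⟩
          lineSum w l   ∎
          where
            lineSum>0 : 0 < lineSum w l
            lineSum>0 = <-≤-trans wP>0 (subst (λ x → (if x then w P else 0) ≤ lineSum w l) P∈l (f[i]≤∑f _ P))

  signed-swap-∣ : ∀ k (a b : Fin v → ℕ) → (∀ l → suc k ∣ lineSum (signed k a b) l) →
    ∀ l → suc k ∣ lineSum (signed k b a) l
  signed-swap-∣ k a b ∣ab l = ∣m+n∣m⇒∣n (subst (suc k ∣_) (sym lineSum-sum) (m∣m*n _)) (∣ab l)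
    where
      onLine : (Fin v → ℕ) → Fin v → ℕ
      onLine w Q = if I Q l then w Q else 0
      pointwise : ∀ Q → onLine (signed k a b) Q + onLine (signed k b a) Q ≡ suc k * onLine (λ R → a R + b R) Q
      pointwise Q with I Q l
      ... | true  = signed-swap-sum k (a Q) (b Q)
      ... | false = sym (*-zeroʳ (suc k))
      lineSum-sum : lineSum (signed k a b) l + lineSum (signed k b a) l ≡ suc k * lineSum (λ Q → a Q + b Q) l
      lineSum-sum = begin
        lineSum (signed k a b) l + lineSum (signed k b a) l          ≡⟨ ∑-distrib-+ (onLine (signed k a b)) (onLine (signed k b a)) ⟨
        ∑[ Q < v ] (onLine (signed k a b) Q + onLine (signed k b a) Q)     ≡⟨ sum-cong-≗ pointwise ⟩
        ∑[ Q < v ] (suc k * onLine (λ R → a R + b R) Q)                 ≡⟨ *-distribˡ-sum (suc k) (onLine (λ R → a R + b R)) ⟨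
        suc k * lineSum (λ Q → a Q + b Q) l                          ∎
        where open ≡-Reasoning

  signed-pencil : ∀ k (a b : Fin v → ℕ) → (∀ l → suc k ∣ lineSum (signed k a b) l) →
    ∀ P → signed k a b P ≡ 1 →
    suc k ∣ sum a + k * sum b + q × suc k * suc q ≤ sum a + k * sum b + q
  signed-pencil k a b ∣ab P signed≡1 = subst (suc k ∣_) total (pencil-∣ _ ∣ab P) ,
    subst (suc k * suc q ≤_) total (pencil-≥ _ ∣ab P (≤-reflexive (sym signed≡1)))
    where
      total : sum (signed k a b) + q * signed k a b P ≡ sum a + k * sum b + q
      total = cong₂ _+_ (sum-signed k a b) (trans (cong (q *_) signed≡1) (*-identityʳ q))

  lineSum-cong : ∀ {w w′ : Fin v → ℕ} → (∀ Q → w Q ≡ w′ Q) → ∀ l → lineSum w l ≡ lineSum w′ l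
  lineSum-cong w≗w′ l = sum-cong-≗ λ Q → cong (if I Q l then_else 0) (w≗w′ Q)

-- Entries 0, 1, −1 over 𝔽_p with p = 3 + t, so that −1 is written as 2 + t.
module TernaryEntries (t : ℕ) where

  Ternary : ℕ → Set
  Ternary x = x ≡ 0 ⊎ x ≡ 1 ⊎ x ≡ 2 + t

  isOne isMinusOne : ℕ → ℕ
  isOne x = indicator ⌊ x ℕ.≟ 1 ⌋
  isMinusOne x = indicator ⌊ x ℕ.≟ 2 + t ⌋

  isMinusOne-minusOne : isMinusOne (2 + t) ≡ 1
  isMinusOne-minusOne rewrite ≟-diag (refl {x = 2 + t}) = refl

  ternary-signed : ∀ {x} → Ternary x → x ≡ signed (2 + t) isOne isMinusOne x
  ternary-signed (inj₁ refl)        = sym (*-zeroʳ (2 + t))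
  ternary-signed (inj₂ (inj₁ refl)) = cong suc (sym (*-zeroʳ (2 + t)))
  ternary-signed (inj₂ (inj₂ refl)) = sym (trans (cong ((2 + t) *_) isMinusOne-minusOne) (*-identityʳ (2 + t)))

  ternary-support : ∀ {x} → Ternary x → indicator (not ⌊ x ℕ.≟ 0 ⌋) ≡ isOne x + isMinusOne x
  ternary-support (inj₁ refl)        = refl
  ternary-support (inj₂ (inj₁ refl)) = refl
  ternary-support (inj₂ (inj₂ refl)) = sym isMinusOne-minusOne

  negated-minusOne : signed (2 + t) isMinusOne isOne (2 + t) ≡ 1
  negated-minusOne = cong₂ _+_ isMinusOne-minusOne (*-zeroʳ (2 + t))

  isMinusOne-pos : ∀ x → 0 < isMinusOne x → x ≡ 2 + t
  isMinusOne-pos x pos with x ℕ.≟ 2 + t | pos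
  ... | yes x≡2+t | _ = x≡2+t
  ... | no _      | ()

module TernaryWord (t : ℕ) {v b q : ℕ} {I : Fin v → Fin b → Bool} (Π : IsProjectivePlane v b q I)
  (d : Fin v → ℕ) (d-ternary : ∀ Q → TernaryEntries.Ternary t (d Q))
  (p∣lineSum : ∀ l → 3 + t ∣ ProjectivePlane.lineSum Π d l) where
  open ProjectivePlane Π
  open TernaryEntries t

  ones minusOnes : Fin v → ℕ
  ones = isOne ∘ d
  minusOnes = isMinusOne ∘ d

  support-sum : ∑[ Q < v ] indicator (not ⌊ d Q ℕ.≟ 0 ⌋) ≡ sum ones + sum minusOnes
  support-sum = trans (sum-cong-≗ (ternary-support ∘ d-ternary)) (∑-distrib-+ ones minusOnes)

  d≡signed : ∀ Q → d Q ≡ signed (2 + t) ones minusOnes Q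
  d≡signed Q = ternary-signed (d-ternary Q)

  p∣lineSum-signed : ∀ l → 3 + t ∣ lineSum (signed (2 + t) ones minusOnes) l
  p∣lineSum-signed l = subst (3 + t ∣_) (lineSum-cong d≡signed l) (p∣lineSum l)

  pencil-at-one : ∀ P → d P ≡ 1 →
    3 + t ∣ sum ones + (2 + t) * sum minusOnes + q × (3 + t) * suc q ≤ sum ones + (2 + t) * sum minusOnes + q
  pencil-at-one P dP≡1 = signed-pencil (2 + t) ones minusOnes p∣lineSum-signed P (trans (sym (d≡signed P)) dP≡1)

  pencil-at-minusOne : ∀ P → 0 < minusOnes P →
    3 + t ∣ sum minusOnes + (2 + t) * sum ones + q × (3 + t) * suc q ≤ sum minusOnes + (2 + t) * sum ones + q
  pencil-at-minusOne P minusOne =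
    signed-pencil (2 + t) minusOnes ones (signed-swap-∣ (2 + t) ones minusOnes p∣lineSum-signed) P
      (trans (cong (signed (2 + t) isMinusOne isOne) (isMinusOne-pos (d P) minusOne)) negated-minusOne)

∣∧≤⇒≡0⊎≡ : ∀ {d n} → d ∣ n → n ≤ d → n ≡ 0 ⊎ n ≡ d
∣∧≤⇒≡0⊎≡ {n = zero}  _   _   = inj₁ refl
∣∧≤⇒≡0⊎≡ {n = suc n} d∣n n≤d = inj₂ (≤-antisym n≤d (∣⇒≤ d∣n))

∣n+k*m⇒∣n∸m : ∀ k {m n} → suc k ∣ n + k * m → m ≤ n → suc k ∣ n ∸ m
∣n+k*m⇒∣n∸m k {m} {n} ∣n+km m≤n = ∣m+n∣m⇒∣n (subst (suc k ∣_) split ∣n+km) (m∣m*n m)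
  where
    shift : ∀ k m x → m + x + k * m ≡ suc k * m + x
    shift = solve-∀
    split : n + k * m ≡ suc k * m + (n ∸ m)
    split = trans (cong (λ n → n + k * m) (sym (m+[n∸m]≡n m≤n))) (shift k m (n ∸ m))

∣m+k*n∧∣n+k*m⇒∣∣m-n∣ : ∀ k {m n} → suc k ∣ m + k * n → suc k ∣ n + k * m → suc k ∣ ∣ m - n ∣
∣m+k*n∧∣n+k*m⇒∣∣m-n∣ k {m} {n} ∣m+kn ∣n+km with ≤-total m n
... | inj₁ m≤n = subst (suc k ∣_) (sym (m≤n⇒∣m-n∣≡n∸m m≤n)) (∣n+k*m⇒∣n∸m k ∣n+km m≤n)
... | inj₂ n≤m = subst (suc k ∣_) (sym (m≤n⇒∣n-m∣≡n∸m n≤m)) (∣n+k*m⇒∣n∸m k ∣m+kn n≤m)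

∣m-n∣+2k≤m+n : ∀ {k m n} → k ≤ m → k ≤ n → ∣ m - n ∣ + 2 * k ≤ m + n
∣m-n∣+2k≤m+n {k} {m} {n} k≤m k≤n =
  subst₂ (λ m n → ∣ m - n ∣ + 2 * k ≤ m + n) (m+[n∸m]≡n k≤m) (m+[n∸m]≡n k≤n) (shifted (m ∸ k) (n ∸ k))
  where
    regroup : ∀ k x y → x + y + 2 * k ≡ k + x + (k + y)
    regroup = solve-∀
    shifted : ∀ x y → ∣ k + x - k + y ∣ + 2 * k ≤ k + x + (k + y)
    shifted x y = begin
      ∣ k + x - k + y ∣ + 2 * k  ≡⟨ cong (_+ 2 * k) (∣m+n-m+o∣≡∣n-o∣ k x y) ⟩
      ∣ x - y ∣ + 2 * k          ≤⟨ +-monoˡ-≤ (2 * k) (≤-trans (∣m-n∣≤m⊔n x y) (m⊔n≤m+n x y)) ⟩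
      x + y + 2 * k              ≡⟨ regroup k x y ⟩
      k + x + (k + y)            ∎
      where open ≤-Reasoning

2p²∸2p≡2p[p∸1] : ∀ p → 2 * p * p ∸ 2 * p ≡ 2 * (p * (p ∸ 1))
2p²∸2p≡2p[p∸1] p = begin
  2 * p * p ∸ 2 * p          ≡⟨ cong₂ _∸_ (*-assoc 2 p p) (cong (2 *_) (sym (*-identityʳ p))) ⟩
  2 * (p * p) ∸ 2 * (p * 1)  ≡⟨ *-distribˡ-∸ 2 (p * p) (p * 1) ⟨
  2 * (p * p ∸ p * 1)        ≡⟨ cong (2 *_) (*-distribˡ-∸ p p 1) ⟨
  2 * (p * (p ∸ 1))          ∎
  where open ≡-Reasoning

module CountArithmetic (t : ℕ) where

  p K : ℕ
  p = 3 + t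
  K = p * (2 + t)

  count-lower-bound : ∀ {A B ε} → A + B ≡ 2 * K + 2 + ε → 2 + ε ≤ p →
    p * suc (p * p) ≤ A + (2 + t) * B + p * p → K ≤ B
  count-lower-bound {A} {B} {ε} A+B≡ 2+ε≤p pencil =
    -- After cancelling 2K + p² and p, the pencil bound reads (p − 2)K ≤ (p − 2)B.
    *-cancelˡ-≤ (1 + t) (+-cancelʳ-≤ p _ _ (+-cancelˡ-≤ (2 * K + p * p) _ _ chain))
    where
      cube : ∀ t → (3 + t) * suc ((3 + t) * (3 + t))
                 ≡ 2 * ((3 + t) * (2 + t)) + (3 + t) * (3 + t) + ((1 + t) * ((3 + t) * (2 + t)) + (3 + t))
      cube = solve-∀
      split : ∀ t A B → A + (2 + t) * B + (3 + t) * (3 + t) ≡ A + B + ((1 + t) * B + (3 + t) * (3 + t))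
      split = solve-∀
      regroup : ∀ t B ε → 2 * ((3 + t) * (2 + t)) + 2 + ε + ((1 + t) * B + (3 + t) * (3 + t))
                        ≡ 2 * ((3 + t) * (2 + t)) + (3 + t) * (3 + t) + ((1 + t) * B + (2 + ε))
      regroup = solve-∀
      chain : 2 * K + p * p + ((1 + t) * K + p) ≤ 2 * K + p * p + ((1 + t) * B + p)
      chain = begin
        2 * K + p * p + ((1 + t) * K + p)          ≡⟨ cube t ⟨
        p * suc (p * p)                            ≤⟨ pencil ⟩
        A + (2 + t) * B + p * p                    ≡⟨ split t A B ⟩
        A + B + ((1 + t) * B + p * p)              ≡⟨ cong (_+ ((1 + t) * B + p * p)) A+B≡ ⟩
        2 * K + 2 + ε + ((1 + t) * B + p * p)      ≡⟨ regroup t B ε ⟩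
        2 * K + p * p + ((1 + t) * B + (2 + ε))    ≤⟨ +-monoʳ-≤ (2 * K + p * p) (+-monoʳ-≤ ((1 + t) * B) 2+ε≤p) ⟩
        2 * K + p * p + ((1 + t) * B + p)          ∎
        where open ≤-Reasoning

  count-difference-dichotomy : ∀ {A B ε} → A + B ≡ 2 * K + 2 + ε → 2 + ε ≤ p → K ≤ A → K ≤ B →
    p ∣ A + (2 + t) * B + p * p → p ∣ B + (2 + t) * A + p * p →
    (∣ A - B ∣ ≡ 0 ⊎ ∣ A - B ∣ ≡ p) × (∣ A - B ∣ ≡ p → ε ≡ 1 + t)
  count-difference-dichotomy {A} {B} {ε} A+B≡ 2+ε≤p K≤A K≤B ∣AB ∣BA =
    ∣∧≤⇒≡0⊎≡ p∣diff (≤-trans diff≤2+ε 2+ε≤p) ,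
    λ diff≡p → suc-injective (suc-injective (≤-antisym 2+ε≤p (subst (_≤ 2 + ε) diff≡p diff≤2+ε)))
    where
      drop-p² : ∀ {n} → p ∣ n + p * p → p ∣ n
      drop-p² {n} p∣n+p² = ∣m+n∣m⇒∣n (subst (p ∣_) (+-comm n (p * p)) p∣n+p²) (m∣m*n p)
      p∣diff : p ∣ ∣ A - B ∣
      p∣diff = ∣m+k*n∧∣n+k*m⇒∣∣m-n∣ (2 + t) {A} {B} (drop-p² ∣AB) (drop-p² ∣BA)
      diff≤2+ε : ∣ A - B ∣ ≤ 2 + ε
      diff≤2+ε = +-cancelʳ-≤ (2 * K) _ _ (begin
        ∣ A - B ∣ + 2 * K  ≤⟨ ∣m-n∣+2k≤m+n K≤A K≤B ⟩
        A + B              ≡⟨ A+B≡ ⟩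
        2 * K + 2 + ε      ≡⟨ +-assoc (2 * K) 2 ε ⟩
        2 * K + (2 + ε)    ≡⟨ +-comm (2 * K) (2 + ε) ⟩
        2 + ε + 2 * K      ∎)
        where open ≤-Reasoning

mainTheorem16 : (p : ℕ) → .{{_ : NonZero p}} → Prime p → p ≥ 3 →
    (v b : ℕ) (I : Fin v → Fin b → Bool) → IsProjectivePlane v b (p * p) I →
    (c : Fin v → Fin p) → InDualCode p I c →
    (ε : ℕ) → 1 ≤ ε → ε ≤ p ∸ 2 →
    weight c ≡ 2 * p * p ∸ 2 * p + 2 + ε →
    (∀ P → toℕ (c P) ≡ 0 ⊎ toℕ (c P) ≡ 1 ⊎ toℕ (c P) ≡ p ∸ 1) →
    (∃ λ P → toℕ (c P) ≡ 1) →
    (∣ entryCount c 1 - entryCount c (p ∸ 1) ∣ ≡ 0 ⊎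
       ∣ entryCount c 1 - entryCount c (p ∸ 1) ∣ ≡ p) ×
    (∣ entryCount c 1 - entryCount c (p ∸ 1) ∣ ≡ p → ε ≡ p ∸ 2)
mainTheorem16 zero _ ()
mainTheorem16 (suc zero) _ (s≤s ())
mainTheorem16 (suc (suc zero)) _ (s≤s (s≤s ()))
mainTheorem16 (suc (suc (suc t))) _ _ v b I Π c c∈C⊥ ε _ ε≤p∸2 weight≡ ternary (P₁ , cP₁≡1) =
  subst₂ (λ A B → (∣ A - B ∣ ≡ 0 ⊎ ∣ A - B ∣ ≡ p) × (∣ A - B ∣ ≡ p → ε ≡ 1 + t))
    (sym (count≡∑ λ Q → ⌊ toℕ (c Q) ℕ.≟ 1 ⌋)) (sym (count≡∑ λ Q → ⌊ toℕ (c Q) ℕ.≟ 2 + t ⌋))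
    (count-difference-dichotomy A+B≡ 2+ε≤p K≤A K≤B (proj₁ pencil₁) (proj₁ pencil₂))
  where
    open CountArithmetic t
    p∣lineSum : ∀ l → p ∣ ProjectivePlane.lineSum Π (toℕ ∘ c) l
    p∣lineSum l = subst (p ∣_) (sumWhere≡∑ _ (toℕ ∘ c)) (m%n≡0⇒n∣m _ p (c∈C⊥ l))
    open TernaryWord t Π (toℕ ∘ c) ternary p∣lineSum
    2+ε≤p : 2 + ε ≤ p
    2+ε≤p = s≤s (s≤s ε≤p∸2)
    A+B≡ : sum ones + sum minusOnes ≡ 2 * K + 2 + ε
    A+B≡ = trans (sym (trans (count≡∑ (λ Q → not ⌊ toℕ (c Q) ℕ.≟ 0 ⌋)) support-sum))
                 (trans weight≡ (cong (λ n → n + 2 + ε) (2p²∸2p≡2p[p∸1] p)))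
    pencil₁ : p ∣ sum ones + (2 + t) * sum minusOnes + p * p × p * suc (p * p) ≤ sum ones + (2 + t) * sum minusOnes + p * p
    pencil₁ = pencil-at-one P₁ cP₁≡1
    K≤B : K ≤ sum minusOnes
    K≤B = count-lower-bound A+B≡ 2+ε≤p (proj₂ pencil₁)
    minusOneEntry : ∃ λ Q → 0 < minusOnes Q
    minusOneEntry = ∑-pos⇒∃-pos minusOnes (≤-trans (s≤s z≤n) K≤B)
    pencil₂ : p ∣ sum minusOnes + (2 + t) * sum ones + p * p × p * suc (p * p) ≤ sum minusOnes + (2 + t) * sum ones + p * p
    pencil₂ = pencil-at-minusOne (proj₁ minusOneEntry) (proj₂ minusOneEntry)
    K≤A : K ≤ sum ones
    K≤A = count-lower-bound (trans (+-comm (sum minusOnes) (sum ones)) A+B≡) 2+ε≤p (proj₂ pencil₂)
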